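{- Let $n\geq 2$ be finite. If $\mathfrak A\in TA_n$ is atomic (its Boolean reduct is atomic), then $\mathfrak A$ is completely representable.
   Context: A $TA_n$-type algebra is a Boolean algebra with unary operations $s_{ij}$, $i\neq j<n$. For a word $w=s_{i_1j_1}\cdots s_{i_kj_k}$ put $\hat w=[i_1,j_1]\circ\cdots\circ[i_k,j_k]\in S_n$, $[i,j]$ the transposition swapping $i,j$. $\Sigma_n$: Boolean algebra axioms; $s_{ij}(x\wedge y)=s_{ij}x\wedge s_{ij}y$; $s_{ij}(-x)=-s_{ij}x$; $w_1(x)=w_2(x)$ whenever $\hat w_1=\hat w_2$. $TA_n=\mathbf{Mod}(\Sigma_n)$. A set $V\subseteq{}^nU$ is permutable if $s\in V$ implies $s\circ[i,j]\in V$ for all $i\neq j<n$; $\wp(V)=\langle\mathcal P(V),\cap,-,S_{ij}\rangle$ with complement relative to $V$ and $S_{ij}(Y)=\{q\in V:q\circ[i,j]\in Y\}$. A complete representation of $\mathfrak A$ is an injective homomorphism $f:\mathfrak A\to\wp(V)$, $V$ permutable, such that $f(\prod X)=\bigcap f[X]$ whenever $X\subseteq A$ and $\prod X$ exists; $\mathfrak A$ is completely representable if it has one. -}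

module Defs where

open import Level using (Level; _⊔_) renaming (suc to lsuc)
open import Data.Nat using (ℕ)
open import Data.Fin using (Fin)
open import Data.Fin.Permutation.Components using (transpose)
open import Data.Product using (Σ; _×_; _,_)
open import Data.Sum using (_⊎_)
open import Data.List using (List; []; _∷_)
open import Function using (_∘_; id)
open import Relation.Binary.PropositionalEquality using (_≡_; _≢_)
open import Relation.Nullary using (¬_)
open import Algebra.Lattice.Bundles using (BooleanAlgebra)

Letter : ℕ → Set
Letter n = Σ (Fin n) λ i → Σ (Fin n) λ j → i ≢ j

[_,_] : ∀ {n} → Fin n → Fin n → Fin n → Fin n
[ i , j ] = transpose i j

hat : ∀ {n} → List (Letter n) → Fin n → Fin n
hat []                  = id
hat ((i , j , _) ∷ w)   = [ i , j ] ∘ hat w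

applyWord : ∀ {c n} {C : Set c} → ((i j : Fin n) → i ≢ j → C → C) →
            List (Letter n) → C → C
applyWord s []                x = x
applyWord s ((i , j , p) ∷ w) x = s i j p (applyWord s w x)

record TA (n : ℕ) (c ℓ : Level) : Set (lsuc (c ⊔ ℓ)) where
  field
    boolean : BooleanAlgebra c ℓ
  open BooleanAlgebra boolean public renaming (¬_ to ∁_)
  field
    s     : (i j : Fin n) → i ≢ j → Carrier → Carrier
    s-cong : ∀ i j (p : i ≢ j) {x y} → x ≈ y → s i j p x ≈ s i j p y
    s-∧   : ∀ i j (p : i ≢ j) x y → s i j p (x ∧ y) ≈ (s i j p x ∧ s i j p y)
    s-¬   : ∀ i j (p : i ≢ j) x → s i j p (∁ x) ≈ ∁ (s i j p x)

  field
    s-words : ∀ (w₁ w₂ : List (Letter n)) →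
              (∀ k → hat w₁ k ≡ hat w₂ k) → ∀ x → applyWord s w₁ x ≈ applyWord s w₂ x

  _≤_ : Carrier → Carrier → Set ℓ
  x ≤ y = (x ∧ y) ≈ x

  IsAtom : Carrier → Set (c ⊔ ℓ)
  IsAtom a = ¬ (a ≈ ⊥) × (∀ b → b ≤ a → (b ≈ ⊥) ⊎ (b ≈ a))

  Atomic : Set (c ⊔ ℓ)
  Atomic = ∀ x → ¬ (x ≈ ⊥) → Σ Carrier λ a → IsAtom a × a ≤ x

  IsInfimum : (Carrier → Set (c ⊔ ℓ)) → Carrier → Set (c ⊔ ℓ)
  IsInfimum X m = (∀ x → X x → m ≤ x) ×
                  (∀ b → (∀ x → X x → b ≤ x) → b ≤ m)

module SetAlgebra {n : ℕ} {u v : Level} {U : Set u} (V : (Fin n → U) → Set v) where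

  Permutable : Set (u ⊔ v)
  Permutable = ∀ q → V q → ∀ (i j : Fin n) → i ≢ j → V (q ∘ [ i , j ])

  _≐_ : ∀ {a b} → ((Fin n → U) → Set a) → ((Fin n → U) → Set b) → Set (u ⊔ a ⊔ b)
  Y ≐ Z = (∀ q → Y q → Z q) × (∀ q → Z q → Y q)

  _∩_ : ∀ {a} → ((Fin n → U) → Set a) → ((Fin n → U) → Set a) → (Fin n → U) → Set a
  (Y ∩ Z) q = Y q × Z q

  -_ : ∀ {a} → ((Fin n → U) → Set a) → (Fin n → U) → Set (v ⊔ a)
  (- Y) q = V q × ¬ Y q

  S : ∀ {a} → Fin n → Fin n → ((Fin n → U) → Set a) → (Fin n → U) → Set (v ⊔ a)
  S i j Y q = V q × Y (q ∘ [ i , j ])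

module _ {n : ℕ} {c ℓ : Level} (𝔄 : TA n c ℓ) where
  open TA 𝔄

  record CompleteRepresentation
           {U : Set (c ⊔ ℓ)} (V : (Fin n → U) → Set (c ⊔ ℓ))
           : Set (lsuc (c ⊔ ℓ)) where
    open SetAlgebra V
    field
      permutable : Permutable
      f          : Carrier → (Fin n → U) → Set (c ⊔ ℓ)
      f⊆V        : ∀ x q → f x q → V q
      f-cong     : ∀ {x y} → x ≈ y → f x ≐ f y
      f-∧        : ∀ x y → f (x ∧ y) ≐ (f x ∩ f y)
      f-¬        : ∀ x → f (∁ x) ≐ (- f x)
      f-s        : ∀ i j (p : i ≢ j) x → f (s i j p x) ≐ S i j (f x)
      f-inj      : ∀ {x y} → f x ≐ f y → x ≈ y
      -- preserves all existing infima: f(∏X) = ⋂ f[X]  (⋂ ∅ = V)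
      f-complete : ∀ (X : Carrier → Set (c ⊔ ℓ)) m → IsInfimum X m →
                   f m ≐ (λ q → V q × (∀ x → X x → f x q))

  CompletelyRepresentable : Set (lsuc (c ⊔ ℓ))
  CompletelyRepresentable =
    Σ (Set (c ⊔ ℓ)) λ U → Σ ((Fin n → U) → Set (c ⊔ ℓ)) λ V →
      CompleteRepresentation {U = U} V

-- The representation is built from the atom structure.  Points of the base
-- set are pairs (a , k) of an atom a and an index k < n; a "presented"
-- sequence is one of the form  k ↦ (a , ŵ k)  for an atom a and a word w,
-- and V is the set of presented sequences.  A sequence presented by (a , w)
-- lies in f(x) iff  a ≤ w(x).
--
-- Membership in f(x) does not
--     depend on the chosen presentation (this is where n ≥ 1 is used); from
--     this, f is a homomorphism into ℘(V) preserving all existing infima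
--     (using the inverse words), and it is injective when the algebra is
--     atomic (using excluded middle).
module Submission where

open import Defs
open import Level using (Level; _⊔_; Lift; lift; lower)
open import Data.Nat using (ℕ; zero; suc; _≤_)
open import Axiom.ExcludedMiddle using (ExcludedMiddle)

open import Data.Fin as Fin using (Fin)
open import Data.Fin.Permutation.Components using (transpose; transpose-inverse)
open import Data.Product using (Σ; _×_; _,_; proj₁; proj₂)
open import Data.Sum using (_⊎_; inj₁; inj₂)
open import Data.List using (List; []; _∷_; _++_)
open import Data.Empty using (⊥-elim)
import Data.Empty as Empty
open import Function using (_∘_)
open import Relation.Binary.PropositionalEquality as Eq using (_≡_; _≢_; refl; cong; subst)
open import Relation.Nullary using (¬_; yes; no)
open import Algebra.Lattice.Bundles using (BooleanAlgebra)
open import Relation.Binary.Lattice.Bundles using (MeetSemilattice)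
import Algebra.Lattice.Properties.BooleanAlgebra as BooleanAlgebraProperties
import Algebra.Lattice.Properties.Lattice as LatticeProperties
import Relation.Binary.Reasoning.Setoid as SetoidReasoning

-- The
-- definitions of _⊑_, IsAtom and Atomic unfold to those of TA._≤_,
-- TA.IsAtom and TA.Atomic on the Boolean reduct of a TA_n-type algebra.
module BooleanOrder {c ℓ : Level} (B : BooleanAlgebra c ℓ) where
  open BooleanAlgebra B renaming (¬_ to ∁_)
  open BooleanAlgebraProperties B using (∧-zeroʳ; ∧-identityʳ; ∨-identityʳ; ¬-involutive)
  open LatticeProperties lattice using (∧-orderTheoreticMeetSemilattice)
  open SetoidReasoning setoid

  -- The library's natural order  x ≈ x ∧ y  is the same order, stated symmetrically.
  private
    module Natural = MeetSemilattice ∧-orderTheoreticMeetSemilattice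

  infix 4 _⊑_
  _⊑_ : Carrier → Carrier → Set ℓ
  x ⊑ y = (x ∧ y) ≈ x

  IsAtom : Carrier → Set (c ⊔ ℓ)
  IsAtom a = ¬ (a ≈ ⊥) × (∀ b → b ⊑ a → (b ≈ ⊥) ⊎ (b ≈ a))

  Atomic : Set (c ⊔ ℓ)
  Atomic = ∀ x → ¬ (x ≈ ⊥) → Σ Carrier λ a → IsAtom a × a ⊑ x

  ⊑-trans : ∀ {x y z} → x ⊑ y → y ⊑ z → x ⊑ z
  ⊑-trans x⊑y y⊑z = sym (Natural.trans (sym x⊑y) (sym y⊑z))

  ⊑-antisym : ∀ {x y} → x ⊑ y → y ⊑ x → x ≈ y
  ⊑-antisym x⊑y y⊑x = Natural.antisym (sym x⊑y) (sym y⊑x)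

  ⊑-respˡ : ∀ {x x′ y} → x ≈ x′ → x ⊑ y → x′ ⊑ y
  ⊑-respˡ x≈x′ x⊑y = sym (Natural.≤-respˡ-≈ x≈x′ (sym x⊑y))

  ⊑-respʳ : ∀ {x y y′} → y ≈ y′ → x ⊑ y → x ⊑ y′
  ⊑-respʳ y≈y′ x⊑y = sym (Natural.≤-respʳ-≈ y≈y′ (sym x⊑y))

  x∧y⊑x : ∀ x y → x ∧ y ⊑ x
  x∧y⊑x x y = sym (Natural.x∧y≤x x y)

  x∧y⊑y : ∀ x y → x ∧ y ⊑ y
  x∧y⊑y x y = sym (Natural.x∧y≤y x y)

  ∧-greatest : ∀ {x y z} → x ⊑ y → x ⊑ z → x ⊑ y ∧ z
  ∧-greatest x⊑y x⊑z = sym (Natural.∧-greatest (sym x⊑y) (sym x⊑z))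

  disjoint⇒⊑ : ∀ {x y} → x ∧ ∁ y ≈ ⊥ → x ⊑ y
  disjoint⇒⊑ {x} {y} x∧∁y≈⊥ = sym (begin
    x                     ≈⟨ sym (∧-identityʳ x) ⟩
    x ∧ ⊤                 ≈⟨ ∧-congˡ (sym (∨-complementʳ y)) ⟩
    x ∧ (y ∨ ∁ y)         ≈⟨ ∧-distribˡ-∨ x y (∁ y) ⟩
    (x ∧ y) ∨ (x ∧ ∁ y)   ≈⟨ ∨-congˡ x∧∁y≈⊥ ⟩
    (x ∧ y) ∨ ⊥           ≈⟨ ∨-identityʳ (x ∧ y) ⟩
    x ∧ y                 ∎)

  nonzero-not-below-both : ∀ {a u} → ¬ (a ≈ ⊥) → a ⊑ u → a ⊑ ∁ u → Empty.⊥
  nonzero-not-below-both {a} {u} a≉⊥ a⊑u a⊑∁u =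
    a≉⊥ (trans (sym (⊑-respʳ (∧-complementʳ u) (∧-greatest a⊑u a⊑∁u))) (∧-zeroʳ a))

  atom-below-complement : ∀ {a u} → IsAtom a → ¬ (a ⊑ u) → a ⊑ ∁ u
  atom-below-complement {a} {u} (_ , minimal) a⋢u with minimal (a ∧ u) (x∧y⊑x a u)
  ... | inj₂ a∧u≈a = ⊥-elim (a⋢u a∧u≈a)
  ... | inj₁ a∧u≈⊥ = disjoint⇒⊑ (trans (∧-congˡ (¬-involutive u)) a∧u≈⊥)

  -- In an atomic Boolean algebra, x ≤ y iff every atom below x is below y.
  -- Classically: if x ∧ ∁y ≠ ⊥, an atom below it is below x but not below y.
  atoms-determine-order : ExcludedMiddle (c ⊔ ℓ) → Atomic →
                          ∀ {x y} → (∀ a → IsAtom a → a ⊑ x → a ⊑ y) → x ⊑ y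
  atoms-determine-order em atomic {x} {y} atoms⊑ with em {Lift c (x ∧ ∁ y ≈ ⊥)}
  ... | yes (lift x∧∁y≈⊥) = disjoint⇒⊑ x∧∁y≈⊥
  ... | no x∧∁y≉⊥ =
    let (a , a-atom , a⊑x∧∁y) = atomic (x ∧ ∁ y) (x∧∁y≉⊥ ∘ lift)
    in ⊥-elim (nonzero-not-below-both (proj₁ a-atom)
                 (atoms⊑ a a-atom (⊑-trans a⊑x∧∁y (x∧y⊑x x (∁ y))))
                 (⊑-trans a⊑x∧∁y (x∧y⊑y x (∁ y))))

-- Words in the operators s_ij.  The axiom  w₁(x) = w₂(x)  whenever ŵ₁ = ŵ₂
-- makes every word act as a Boolean automorphism whose inverse is the
-- reversed word with each letter s_ij read as s_ji.
module WordAction {n : ℕ} {c ℓ : Level} (𝔄 : TA n c ℓ) where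
  open TA 𝔄 hiding (_≤_; IsAtom; Atomic) renaming (refl to ≈-refl)
  open BooleanOrder boolean

  Word : Set
  Word = List (Letter n)

  act : Word → Carrier → Carrier
  act = applyWord s

  hat-++ : ∀ (w v : Word) k → hat (w ++ v) k ≡ hat w (hat v k)
  hat-++ []                v k = refl
  hat-++ ((i , j , _) ∷ w) v k = cong (transpose i j) (hat-++ w v k)

  act-++ : ∀ (w v : Word) x → act (w ++ v) x ≡ act w (act v x)
  act-++ []                v x = refl
  act-++ ((i , j , p) ∷ w) v x = cong (s i j p) (act-++ w v x)

  flipLetter : Letter n → Letter n
  flipLetter (i , j , i≢j) = j , i , i≢j ∘ Eq.sym

  inverse : Word → Word
  inverse []      = []
  inverse (l ∷ w) = inverse w ++ (flipLetter l ∷ [])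

  hat-inverseˡ : ∀ w k → hat (inverse w) (hat w k) ≡ k
  hat-inverseˡ []                k = refl
  hat-inverseˡ ((i , j , _) ∷ w) k = begin
    hat (inverse w ++ _) (transpose i j (hat w k)) ≡⟨ hat-++ (inverse w) _ _ ⟩
    hat (inverse w) (transpose j i (transpose i j (hat w k)))
      ≡⟨ cong (hat (inverse w)) (transpose-inverse j i) ⟩
    hat (inverse w) (hat w k)                      ≡⟨ hat-inverseˡ w k ⟩
    k                                              ∎
    where open Eq.≡-Reasoning

  hat-inverseʳ : ∀ w k → hat w (hat (inverse w) k) ≡ k
  hat-inverseʳ []                k = refl
  hat-inverseʳ ((i , j , _) ∷ w) k = begin
    transpose i j (hat w (hat (inverse w ++ _) k))
      ≡⟨ cong (transpose i j ∘ hat w) (hat-++ (inverse w) _ k) ⟩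
    transpose i j (hat w (hat (inverse w) (transpose j i k)))
      ≡⟨ cong (transpose i j) (hat-inverseʳ w (transpose j i k)) ⟩
    transpose i j (transpose j i k)                ≡⟨ transpose-inverse i j ⟩
    k                                              ∎
    where open Eq.≡-Reasoning

  -- w(w⁻¹(x)) = x = w⁻¹(w(x)), because the composite words have ŵ = id.
  act-inverseˡ : ∀ w x → act (inverse w) (act w x) ≈ x
  act-inverseˡ w x = subst (_≈ x) (act-++ (inverse w) w x)
    (s-words (inverse w ++ w) []
      (λ k → Eq.trans (hat-++ (inverse w) w k) (hat-inverseˡ w k)) x)

  act-inverseʳ : ∀ w x → act w (act (inverse w) x) ≈ x
  act-inverseʳ w x = subst (_≈ x) (act-++ w (inverse w) x)
    (s-words (w ++ inverse w) []
      (λ k → Eq.trans (hat-++ w (inverse w) k) (hat-inverseʳ w k)) x)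

  act-cong : ∀ w {x y} → x ≈ y → act w x ≈ act w y
  act-cong []                x≈y = x≈y
  act-cong ((i , j , p) ∷ w) x≈y = s-cong i j p (act-cong w x≈y)

  act-∧ : ∀ w x y → act w (x ∧ y) ≈ act w x ∧ act w y
  act-∧ []                x y = ≈-refl
  act-∧ ((i , j , p) ∷ w) x y = trans (s-cong i j p (act-∧ w x y)) (s-∧ i j p _ _)

  act-∁ : ∀ w x → act w (∁ x) ≈ ∁ act w x
  act-∁ []                x = ≈-refl
  act-∁ ((i , j , p) ∷ w) x = trans (s-cong i j p (act-∁ w x)) (s-¬ i j p _)

  act-mono : ∀ w {x y} → x ⊑ y → act w x ⊑ act w y
  act-mono w {x} {y} x⊑y = trans (sym (act-∧ w x y)) (act-cong w x⊑y)

  adjoint→ : ∀ w {a x} → a ⊑ act w x → act (inverse w) a ⊑ x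
  adjoint→ w {a} {x} a⊑wx = ⊑-respʳ (act-inverseˡ w x) (act-mono (inverse w) a⊑wx)

  adjoint← : ∀ w {a x} → act (inverse w) a ⊑ x → a ⊑ act w x
  adjoint← w {a} {x} w⁻¹a⊑x = ⊑-respˡ (act-inverseʳ w a) (act-mono w w⁻¹a⊑x)

-- The representation of a TA_n-type algebra on its atom structure.  The
-- index k₀ only witnesses n ≥ 1: it lets a presented sequence determine its
-- atom.
module AtomStructure {n : ℕ} {c ℓ : Level} (𝔄 : TA n c ℓ) (k₀ : Fin n) where
  open TA 𝔄 hiding (_≤_; IsAtom; Atomic; refl)
  open BooleanOrder boolean
  open WordAction 𝔄

  U : Set (c ⊔ ℓ)
  U = Lift ℓ (Carrier × Fin n)

  point : Carrier → Word → Fin n → U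
  point a w k = lift (a , hat w k)

  record Presentation (q : Fin n → U) : Set (c ⊔ ℓ) where
    constructor presentation
    field
      atom    : Carrier
      word    : Word
      isAtom  : IsAtom atom
      matches : ∀ k → q k ≡ point atom word k
  open Presentation

  V : (Fin n → U) → Set (c ⊔ ℓ)
  V = Presentation

  trivial : ∀ {a} → IsAtom a → Presentation (point a [])
  trivial {a} a-atom = presentation a [] a-atom (λ _ → refl)

  shift : ∀ {q} i j (i≢j : i ≢ j) → Presentation q → Presentation (q ∘ [ i , j ])
  shift i j i≢j (presentation a w a-atom q≡) =
    presentation a (w ++ ((i , j , i≢j) ∷ [])) a-atom
      (λ k → Eq.trans (q≡ (transpose i j k))
               (cong (λ m → lift (a , m)) (Eq.sym (hat-++ w _ k))))

  Holds : ∀ {q} → Presentation q → Carrier → Set ℓ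
  Holds p x = atom p ⊑ act (word p) x

  -- Two presentations of the same sequence have the same atom and the same
  -- permutation ŵ, hence agree on Holds.
  holds-transfer : ∀ {q} (p p′ : Presentation q) {x} → Holds p′ x → Holds p x
  holds-transfer {q} (presentation a w _ q≡) (presentation a′ w′ _ q≡′) {x} a′⊑w′x =
    ⊑-respʳ (s-words w′ w (λ k → Eq.sym (same-hat k)) x)
            (subst (_⊑ act w′ x) (Eq.sym same-atom) a′⊑w′x)
    where
      same-point : ∀ k → point a w k ≡ point a′ w′ k
      same-point k = Eq.trans (Eq.sym (q≡ k)) (q≡′ k)
      same-atom : a ≡ a′
      same-atom = cong (proj₁ ∘ lower) (same-point k₀)
      same-hat : ∀ k → hat w k ≡ hat w′ k
      same-hat k = cong (proj₂ ∘ lower) (same-point k)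

  holds-s→ : ∀ {q} (p : Presentation q) i j (i≢j : i ≢ j) x →
             Holds p (s i j i≢j x) → Holds (shift i j i≢j p) x
  holds-s→ p i j i≢j x = subst (atom p ⊑_) (Eq.sym (act-++ (word p) _ x))

  holds-s← : ∀ {q} (p : Presentation q) i j (i≢j : i ≢ j) x →
             Holds (shift i j i≢j p) x → Holds p (s i j i≢j x)
  holds-s← p i j i≢j x = subst (atom p ⊑_) (act-++ (word p) _ x)

  f : Carrier → (Fin n → U) → Set (c ⊔ ℓ)
  f x q = Σ (Presentation q) λ p → Holds p x

  f-holds : ∀ {x q} → f x q → (p : Presentation q) → Holds p x
  f-holds (p′ , holds) p = holds-transfer p p′ holds

  open SetAlgebra V

  permutable : Permutable
  permutable q p i j i≢j = shift i j i≢j p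

  f-cong : ∀ {x y} → x ≈ y → f x ≐ f y
  f-cong x≈y = (λ { q (p , holds) → p , ⊑-respʳ (act-cong (word p) x≈y) holds })
             , (λ { q (p , holds) → p , ⊑-respʳ (act-cong (word p) (sym x≈y)) holds })

  f-∧ : ∀ x y → f (x ∧ y) ≐ (f x ∩ f y)
  f-∧ x y =
    (λ { q (p , holds) →
         let holds′ = ⊑-respʳ (act-∧ (word p) x y) holds
         in (p , ⊑-trans holds′ (x∧y⊑x _ _)) , (p , ⊑-trans holds′ (x∧y⊑y _ _)) }) ,
    (λ { q ((p , holds-x) , in-y) →
         p , ⊑-respʳ (sym (act-∧ (word p) x y)) (∧-greatest holds-x (f-holds in-y p)) })

  f-∁ : ∀ x → f (∁ x) ≐ (- f x)
  f-∁ x =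
    (λ { q (p , holds) →
         p , (λ in-x → nonzero-not-below-both (proj₁ (isAtom p)) (f-holds in-x p)
                         (⊑-respʳ (act-∁ (word p) x) holds)) }) ,
    (λ { q (p , not-in-x) →
         p , ⊑-respʳ (sym (act-∁ (word p) x))
               (atom-below-complement (isAtom p) (λ holds → not-in-x (p , holds))) })

  f-s : ∀ i j (i≢j : i ≢ j) x → f (s i j i≢j x) ≐ S i j (f x)
  f-s i j i≢j x =
    (λ { q (p , holds) → p , shift i j i≢j p , holds-s→ p i j i≢j x holds }) ,
    (λ { q (p , in-x) →
         p , holds-s← p i j i≢j x (f-holds in-x (shift i j i≢j p)) })

  -- f preserves every existing infimum: if a ≤ w(x) for all x ∈ X then
  -- w⁻¹(a) is a lower bound of X, so w⁻¹(a) ≤ ∏X and a ≤ w(∏X).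
  f-complete : ∀ (X : Carrier → Set (c ⊔ ℓ)) m → TA.IsInfimum 𝔄 X m →
               f m ≐ (λ q → V q × (∀ x → X x → f x q))
  f-complete X m (lower-bound , greatest) =
    (λ { q (p , holds) →
         p , (λ x x∈X → p , ⊑-trans holds (act-mono (word p) (lower-bound x x∈X))) }) ,
    (λ { q (p , in-all) →
         p , adjoint← (word p)
               (greatest _ (λ x x∈X → adjoint→ (word p) (f-holds (in-all x x∈X) p))) })

  -- In an atomic algebra f is injective: an atom a ≤ x yields the sequence
  -- k ↦ (a , k) in f(x), hence in f(y), hence a ≤ y.
  f-inj : ExcludedMiddle (c ⊔ ℓ) → TA.Atomic 𝔄 → ∀ {x y} → f x ≐ f y → x ≈ y
  f-inj em atomic (fx⊆fy , fy⊆fx) = ⊑-antisym (included fx⊆fy) (included fy⊆fx)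
    where
      included : ∀ {x y} → (∀ q → f x q → f y q) → x ⊑ y
      included fx⊆fy = atoms-determine-order em atomic λ a a-atom a⊑x →
        f-holds (fx⊆fy _ (trivial a-atom , a⊑x)) (trivial a-atom)

  representation : ExcludedMiddle (c ⊔ ℓ) → TA.Atomic 𝔄 → CompleteRepresentation 𝔄 V
  representation em atomic = record
    { permutable = permutable
    ; f          = f
    ; f⊆V        = λ x q → proj₁
    ; f-cong     = f-cong
    ; f-∧        = f-∧
    ; f-¬        = f-∁
    ; f-s        = f-s
    ; f-inj      = f-inj em atomic
    ; f-complete = f-complete
    }

mainTheorem6 : ∀ {c ℓ : Level} → ExcludedMiddle (c ⊔ ℓ) →
    (n : ℕ) → 2 ≤ n →
    (𝔄 : TA n c ℓ) → TA.Atomic 𝔄 → CompletelyRepresentable 𝔄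
mainTheorem6 em zero    ()
mainTheorem6 em (suc m) _  𝔄 atomic = U , V , representation em atomic
  where open AtomStructure 𝔄 Fin.zero
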